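{- The subobject classifier $\Omega$ of $\mathcal K=\mathbf{Sh}(\mathbf{Kp},J)$, as a sheaf on $\mathbf{Kp}$, satisfies $\Omega(P)\cong\mathcal UP$ for every $P\in\mathbf{Kp}$, where $\mathcal UP$ is the set of upward closed subsets of $P$.
   Context: $\mathbf{Kp}$ is the category of finite posets and open maps (monotone $f:P\to Q$ such that $f(p)\le q$ implies there is $p'\ge p$ with $f(p')=q$); $J$ is the Grothendieck topology on $\mathbf{Kp}$ whose covering sieves are the jointly surjective ones. -}

module Defs where

open import Level using (0ℓ) renaming (suc to lsuc)
open import Data.Nat using (ℕ)
open import Data.Fin using (Fin)
open import Data.Product using (Σ; ∃; _×_; _,_)
open import Relation.Binary using (Rel; Decidable; IsPartialOrder; Setoid; IsEquivalence)
open import Relation.Binary.PropositionalEquality using (_≡_; trans; cong)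
open import Function using (_⇔_; _∘_)
open import Function.Properties.Equivalence using (⇔-isEquivalence)

record FinPoset : Set₁ where
  field
    size    : ℕ
    _≤_     : Fin size → Fin size → Set
    isPO    : IsPartialOrder _≡_ _≤_
    _≤?_    : Decidable _≤_

  El : Set
  El = Fin size

open FinPoset public using (El)

-- Morphisms of Kp: open maps (monotone, and f p ≤ q ⇒ ∃ p' ≥ p, f p' = q).
record OpenMap (P Q : FinPoset) : Set where
  private
    module P = FinPoset P
    module Q = FinPoset Q
  field
    fun  : El P → El Q
    mono : ∀ {p p'} → p P.≤ p' → fun p Q.≤ fun p'
    open-lift : ∀ p q → fun p Q.≤ q → Σ (El P) λ p' → p P.≤ p' × fun p' ≡ q

open OpenMap public

_∘ₒ_ : ∀ {P Q R} → OpenMap Q R → OpenMap P Q → OpenMap P R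
_∘ₒ_ {P} {Q} {R} g f = record
  { fun = fun g ∘ fun f
  ; mono = λ le → mono g (mono f le)
  ; open-lift = lift
  }
  where
  module P = FinPoset P
  module R = FinPoset R
  lift : ∀ p r → fun g (fun f p) R.≤ r → Σ (El P) λ p' → p P.≤ p' × fun g (fun f p') ≡ r
  lift p r le with open-lift g (fun f p) r le
  ... | q' , fp≤q' , gq'≡r with open-lift f p q' fp≤q'
  ... | p' , p≤p' , fp'≡q' = p' , p≤p' , trans (cong (fun g) fp'≡q') gq'≡r

_≈ₒ_ : ∀ {P Q} → OpenMap P Q → OpenMap P Q → Set
f ≈ₒ g = ∀ x → fun f x ≡ fun g x

record Sieve (P : FinPoset) : Set₁ where
  field
    _∋_   : ∀ {Q} → OpenMap Q P → Set
    resp  : ∀ {Q} {f g : OpenMap Q P} → f ≈ₒ g → _∋_ f → _∋_ g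
    precomp : ∀ {Q R} (f : OpenMap Q P) (g : OpenMap R Q) → _∋_ f → _∋_ (f ∘ₒ g)

open Sieve public

pullback : ∀ {P Q} → Sieve P → OpenMap Q P → ∀ {R} → OpenMap R Q → Set
pullback S f g = S ∋ (f ∘ₒ g)

-- J-covering families: jointly surjective.
Covers : ∀ {P} → (∀ {Q} → OpenMap Q P → Set) → Set₁
Covers {P} S = ∀ (p : El P) →
  Σ FinPoset λ Q → Σ (OpenMap Q P) λ f → S f × Σ (El Q) λ q → fun f q ≡ p

IsClosed : ∀ {P} → Sieve P → Set₁
IsClosed {P} S = ∀ {Q} (f : OpenMap Q P) → Covers (pullback S f) → S ∋ f

-- Ω(P) in Sh(Kp,J): the J-closed sieves on P, up to equality of sieves.
record ClosedSieve (P : FinPoset) : Set₁ where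
  field
    sieve  : Sieve P
    closed : IsClosed sieve

open ClosedSieve public

ΩSetoid : FinPoset → Setoid (lsuc 0ℓ) (lsuc 0ℓ)
ΩSetoid P = record
  { Carrier = ClosedSieve P
  ; _≈_ = λ S T → ∀ {Q} (f : OpenMap Q P) → (sieve S ∋ f) ⇔ (sieve T ∋ f)
  ; isEquivalence = record
    { refl = λ f → IsEquivalence.refl ⇔-isEquivalence
    ; sym = λ e f → IsEquivalence.sym ⇔-isEquivalence (e f)
    ; trans = λ e e' f → IsEquivalence.trans ⇔-isEquivalence (e f) (e' f)
    }
  }

record UpSet (P : FinPoset) : Set₁ where
  private module P = FinPoset P
  field
    member : El P → Set
    upward : ∀ {p q} → p P.≤ q → member p → member q

open UpSet public

UpSetoid : FinPoset → Setoid (lsuc 0ℓ) 0ℓ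
UpSetoid P = record
  { Carrier = UpSet P
  ; _≈_ = λ U V → ∀ p → member U p ⇔ member V p
  ; isEquivalence = record
    { refl = λ p → IsEquivalence.refl ⇔-isEquivalence
    ; sym = λ e p → IsEquivalence.sym ⇔-isEquivalence (e p)
    ; trans = λ e e' p → IsEquivalence.trans ⇔-isEquivalence (e p) (e' p)
    }
  }

{-# OPTIONS --safe #-}
module Submission where

open import Defs
open import Function.Bundles using (Inverse)

open import Data.Nat using (suc)
open import Data.Fin using (Fin; zero; suc; _≟_)
open import Data.Empty using (⊥; ⊥-elim)
open import Data.Product using (Σ; _×_; _,_)
open import Function using (_⇔_; mk⇔; Equivalence)
open import Function.Properties.Equivalence using () renaming (sym to ⇔-sym; trans to ⇔-trans)
open import Relation.Binary using (Decidable; IsPartialOrder; Setoid)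
open import Relation.Binary.PropositionalEquality
  using (_≡_; refl; sym; trans; cong; subst; isEquivalence)
open import Relation.Nullary using (¬_; Dec; yes; no)
open import Relation.Nullary.Decidable using (map′)

-- A closed sieve S on P is determined by the points p for which the
-- principal up-set ↑p ↪ P lies in S.  A map h : R → P lies in S iff
-- ↑(h r) ↪ P does for every r: the maps ↑r ↪ R cover R and h restricted
-- to ↑r factors through ↑(h r), while ↑(h r) is covered by maps factoring
-- through ↑r → R → P, which are in S whenever h is.  Hence S ↦ {p | ↑p ∈ S}
-- is inverse to U ↦ {h | image h ⊆ U}.

-- ↑p has no convenient Fin carrier, so it is replaced by Cone P p on
-- Fin (1 + size): suc i stands for i ∈ P, and the points outside ↑p,
-- together with the extra point zero, become pairwise incomparable points
-- below all of ↑p, which cone P p collapses onto p.  The point zero ensures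
-- that some point lies outside ↑p.
module Cones (P : FinPoset) (p : El P) where
  open FinPoset P using (size; _≤_; _≤?_; isPO)
  open IsPartialOrder isPO using ()
    renaming (refl to ≤-refl; trans to ≤-trans; antisym to ≤-antisym)

  Above : Fin (suc size) → Set
  Above zero    = ⊥
  Above (suc i) = p ≤ i

  above? : ∀ a → Dec (Above a)
  above? zero    = no λ ()
  above? (suc i) = p ≤? i

  infix 4 _≼_
  data _≼_ : Fin (suc size) → Fin (suc size) → Set where
    ≼-refl    : ∀ {a} → a ≼ a
    ≼-outside : ∀ {a j} → ¬ Above a → p ≤ j → a ≼ suc j
    ≼-above   : ∀ {i j} → p ≤ i → i ≤ j → suc i ≼ suc j

  outside≼above : ∀ {a b} → ¬ Above a → Above b → a ≼ b
  outside≼above {b = suc j} a∉ p≤j = ≼-outside a∉ p≤j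

  ≼-trans : ∀ {a b c} → a ≼ b → b ≼ c → a ≼ c
  ≼-trans ≼-refl                b≼c                 = b≼c
  ≼-trans a≼b                   ≼-refl              = a≼b
  ≼-trans (≼-outside _ p≤j)     (≼-outside j∉ _)    = ⊥-elim (j∉ p≤j)
  ≼-trans (≼-outside a∉ p≤j)    (≼-above _ j≤k)     = ≼-outside a∉ (≤-trans p≤j j≤k)
  ≼-trans (≼-above p≤i i≤j)     (≼-outside j∉ _)    = ⊥-elim (j∉ (≤-trans p≤i i≤j))
  ≼-trans (≼-above p≤i i≤j)     (≼-above _ j≤k)     = ≼-above p≤i (≤-trans i≤j j≤k)

  ≼-antisym : ∀ {a b} → a ≼ b → b ≼ a → a ≡ b
  ≼-antisym ≼-refl              _                   = refl
  ≼-antisym (≼-outside _ _)     ≼-refl              = refl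
  ≼-antisym (≼-outside _ p≤j)   (≼-outside j∉ _)    = ⊥-elim (j∉ p≤j)
  ≼-antisym (≼-outside a∉ p≤j)  (≼-above _ j≤i)     = ⊥-elim (a∉ (≤-trans p≤j j≤i))
  ≼-antisym (≼-above _ _)       ≼-refl              = refl
  ≼-antisym (≼-above p≤i i≤j)   (≼-outside j∉ _)    = ⊥-elim (j∉ (≤-trans p≤i i≤j))
  ≼-antisym (≼-above _ i≤j)     (≼-above _ j≤i)     = cong suc (≤-antisym i≤j j≤i)

  ≼zero⇒≡zero : ∀ {a} → a ≼ zero → a ≡ zero
  ≼zero⇒≡zero ≼-refl = refl

  ≼outside⇒≡ : ∀ {a j} → ¬ p ≤ j → a ≼ suc j → a ≡ suc j
  ≼outside⇒≡ _   ≼-refl             = refl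
  ≼outside⇒≡ p≰j (≼-outside _ p≤j)  = ⊥-elim (p≰j p≤j)
  ≼outside⇒≡ p≰j (≼-above p≤i i≤j)  = ⊥-elim (p≰j (≤-trans p≤i i≤j))

  ≼-above⁻¹ : ∀ {i j} → p ≤ i → suc i ≼ suc j → i ≤ j
  ≼-above⁻¹ _   ≼-refl           = ≤-refl
  ≼-above⁻¹ p≤i (≼-outside i∉ _) = ⊥-elim (i∉ p≤i)
  ≼-above⁻¹ _   (≼-above _ i≤j)  = i≤j

  _≼?_ : Decidable _≼_
  a ≼? zero = map′ (λ { refl → ≼-refl }) ≼zero⇒≡zero (a ≟ zero)
  a ≼? suc j with p ≤? j | above? a
  ... | no p≰j | _      = map′ (λ { refl → ≼-refl }) (≼outside⇒≡ p≰j) (a ≟ suc j)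
  ... | yes p≤j | no a∉ = yes (≼-outside a∉ p≤j)
  zero  ≼? suc j | yes _ | yes ()
  suc i ≼? suc j | yes _ | yes p≤i = map′ (≼-above p≤i) (≼-above⁻¹ p≤i) (i ≤? j)

  poset : FinPoset
  poset = record
    { size  = suc size
    ; _≤_   = _≼_
    ; isPO  = record
      { isPreorder = record
        { isEquivalence = isEquivalence
        ; reflexive     = λ { refl → ≼-refl }
        ; trans         = ≼-trans
        }
      ; antisym = ≼-antisym
      }
    ; _≤?_  = _≼?_
    }

  collapse : Fin (suc size) → El P
  collapse zero = p
  collapse (suc i) with p ≤? i
  ... | yes _ = i
  ... | no  _ = p

  collapse-above : ∀ {i} → p ≤ i → collapse (suc i) ≡ i
  collapse-above {i} p≤i with p ≤? i
  ... | yes _   = refl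
  ... | no  p≰i = ⊥-elim (p≰i p≤i)

  collapse-outside : ∀ a → ¬ Above a → collapse a ≡ p
  collapse-outside zero    _  = refl
  collapse-outside (suc i) i∉ with p ≤? i
  ... | yes p≤i = ⊥-elim (i∉ p≤i)
  ... | no  _   = refl

  p≤collapse : ∀ a → p ≤ collapse a
  p≤collapse zero = ≤-refl
  p≤collapse (suc i) with p ≤? i
  ... | yes p≤i = p≤i
  ... | no  _   = ≤-refl

  collapse-mono : ∀ {a b} → a ≼ b → collapse a ≤ collapse b
  collapse-mono ≼-refl = ≤-refl
  collapse-mono (≼-outside {a} a∉ p≤j)
    rewrite collapse-outside a a∉ | collapse-above p≤j = p≤j
  collapse-mono (≼-above p≤i i≤j)
    rewrite collapse-above p≤i | collapse-above (≤-trans p≤i i≤j) = i≤j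

  collapse≤⇒≼suc : ∀ a {q} → collapse a ≤ q → a ≼ suc q
  collapse≤⇒≼suc a a≤q with above? a
  ... | no a∉ = ≼-outside a∉ (≤-trans (p≤collapse a) a≤q)
  collapse≤⇒≼suc zero    _   | yes ()
  collapse≤⇒≼suc (suc i) i≤q | yes p≤i = ≼-above p≤i (subst (_≤ _) (collapse-above p≤i) i≤q)

  collapse-open : ∀ a q → collapse a ≤ q → Σ (Fin (suc size)) λ a′ → a ≼ a′ × collapse a′ ≡ q
  collapse-open a q a≤q = suc q , collapse≤⇒≼suc a a≤q , collapse-above (≤-trans (p≤collapse a) a≤q)

  proj : OpenMap poset P
  proj = record { fun = collapse ; mono = collapse-mono ; open-lift = collapse-open }

open Cones using (Above; above?) renaming (poset to Cone; proj to cone)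

-- Cone applied to h; the points outside ↑r go to a chosen point c outside ↑(h r).
module ConeMap {R P : FinPoset} (h : OpenMap R P) (r : El R)
               (c : El (Cone P (fun h r))) (c∉ : ¬ Above P (fun h r) c) where
  module R = FinPoset R
  open IsPartialOrder R.isPO using () renaming (trans to ≤-trans)
  module R′ = Cones R r
  module P′ = Cones P (fun h r)
  open P′ using (_≼_; ≼-refl; ≼-outside; ≼-above)

  extend : El (Cone R r) → El (Cone P (fun h r))
  extend zero = c
  extend (suc y) with r R.≤? y
  ... | yes _ = suc (fun h y)
  ... | no  _ = c

  extend-above : ∀ {y} → r R.≤ y → extend (suc y) ≡ suc (fun h y)
  extend-above {y} r≤y with r R.≤? y
  ... | yes _   = refl
  ... | no  r≰y = ⊥-elim (r≰y r≤y)

  extend-outside : ∀ a → ¬ Above R r a → extend a ≡ c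
  extend-outside zero    _  = refl
  extend-outside (suc y) y∉ with r R.≤? y
  ... | yes r≤y = ⊥-elim (y∉ r≤y)
  ... | no  _   = refl

  extend-mono : ∀ {a b} → a R′.≼ b → extend a ≼ extend b
  extend-mono R′.≼-refl = ≼-refl
  extend-mono (R′.≼-outside {a} a∉ r≤j)
    rewrite extend-outside a a∉ | extend-above r≤j = ≼-outside c∉ (mono h r≤j)
  extend-mono (R′.≼-above r≤i i≤j)
    rewrite extend-above r≤i | extend-above (≤-trans r≤i i≤j) = ≼-above (mono h r≤i) (mono h i≤j)

  OpenLift : El (Cone R r) → El (Cone P (fun h r)) → Set
  OpenLift a w = Σ (El (Cone R r)) λ a′ → a R′.≼ a′ × extend a′ ≡ w

  open-lift-outside : ∀ {a w} → ¬ Above R r a → c ≼ w → OpenLift a w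
  open-lift-outside {a} a∉ ≼-refl = a , R′.≼-refl , extend-outside a a∉
  open-lift-outside {a} a∉ (≼-outside {j = j} _ hr≤j) with open-lift h r j hr≤j
  ... | r′ , r≤r′ , hr′≡j =
    suc r′ , R′.≼-outside a∉ r≤r′ , trans (extend-above r≤r′) (cong suc hr′≡j)
  open-lift-outside a∉ (≼-above hr≤i _) = ⊥-elim (c∉ hr≤i)

  open-lift-above : ∀ {y w} → r R.≤ y → suc (fun h y) ≼ w → OpenLift (suc y) w
  open-lift-above {y} r≤y ≼-refl = suc y , R′.≼-refl , extend-above r≤y
  open-lift-above r≤y (≼-outside hy∉ _) = ⊥-elim (hy∉ (mono h r≤y))
  open-lift-above {y} r≤y (≼-above {j = j} _ hy≤j) with open-lift h y j hy≤j
  ... | y′ , y≤y′ , hy′≡j =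
    suc y′ , R′.≼-above r≤y y≤y′ , trans (extend-above (≤-trans r≤y y≤y′)) (cong suc hy′≡j)

  extend-open : ∀ a w → extend a ≼ w → OpenLift a w
  extend-open a w le with above? R r a
  ... | no a∉ = open-lift-outside a∉ (subst (_≼ w) (extend-outside a a∉) le)
  extend-open zero    w _  | yes ()
  extend-open (suc y) w le | yes r≤y = open-lift-above r≤y (subst (_≼ w) (extend-above r≤y) le)

  coneMap : OpenMap (Cone R r) (Cone P (fun h r))
  coneMap = record { fun = extend ; mono = extend-mono ; open-lift = extend-open }

  cone∘coneMap≈h∘cone : (cone P (fun h r) ∘ₒ coneMap) ≈ₒ (h ∘ₒ cone R r)
  cone∘coneMap≈h∘cone a with above? R r a
  ... | no a∉ rewrite extend-outside a a∉ | R′.collapse-outside a a∉ = P′.collapse-outside c c∉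
  cone∘coneMap≈h∘cone zero    | yes ()
  cone∘coneMap≈h∘cone (suc y) | yes r≤y
    rewrite extend-above r≤y | R′.collapse-above r≤y = P′.collapse-above (mono h r≤y)

open ConeMap using (coneMap; cone∘coneMap≈h∘cone)

coneMap-covers : ∀ {R P} (h : OpenMap R P) (r : El R) (x : El (Cone P (fun h r))) →
  Σ (El (Cone P (fun h r))) λ c → Σ (¬ Above P (fun h r) c) λ c∉ →
  Σ (El (Cone R r)) λ a → fun (coneMap h r c c∉) a ≡ x
coneMap-covers h r x with above? _ _ x
... | no x∉ = x , x∉ , zero , refl
... | yes x∈ with open-lift (coneMap h r zero λ ()) zero x (Cones.outside≼above _ _ (λ ()) x∈)
...   | a , _ , e = zero , (λ ()) , a , e

∋⇔cones∋ : ∀ {P R} (S : ClosedSieve P) (h : OpenMap R P) →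
           sieve S ∋ h ⇔ (∀ r → sieve S ∋ cone P (fun h r))
∋⇔cones∋ {P} {R} S h = mk⇔ cones∋ ∋h
  where
  cones∋ : sieve S ∋ h → ∀ r → sieve S ∋ cone P (fun h r)
  cones∋ h∈S r = closed S (cone P (fun h r)) λ x →
    let c , c∉ , a , e = coneMap-covers h r x
    in Cone R r , coneMap h r c c∉ ,
       resp (sieve S) (λ a → sym (cone∘coneMap≈h∘cone h r c c∉ a)) (precomp (sieve S) h (cone R r) h∈S) ,
       a , e

  ∋h : (∀ r → sieve S ∋ cone P (fun h r)) → sieve S ∋ h
  ∋h cones∈S = closed S h λ r →
    Cone R r , cone R r ,
    resp (sieve S) (cone∘coneMap≈h∘cone h r zero λ ())
      (precomp (sieve S) (cone P (fun h r)) (coneMap h r zero λ ()) (cones∈S r)) ,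
    zero , refl

module UpSetCorrespondence (P : FinPoset) where
  open FinPoset P using (_≤_)
  open IsPartialOrder (FinPoset.isPO P) using () renaming (refl to ≤-refl)
  open Setoid (ΩSetoid P) using () renaming (_≈_ to _≈Ω_)
  open Setoid (UpSetoid P) using () renaming (_≈_ to _≈𝒰_)

  toUpSet : ClosedSieve P → UpSet P
  toUpSet S = record
    { member = λ p → sieve S ∋ cone P p
    ; upward = upward′
    }
    where
    upward′ : ∀ {p q} → p ≤ q → sieve S ∋ cone P p → sieve S ∋ cone P q
    upward′ {p} {q} p≤q p∈ = subst (λ z → sieve S ∋ cone P z) (Cones.collapse-above P p p≤q)
                                   (Equivalence.to (∋⇔cones∋ S (cone P p)) p∈ (suc q))

  fromUpSet : UpSet P → ClosedSieve P
  fromUpSet U = record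
    { sieve = record
      { _∋_     = λ h → ∀ r → member U (fun h r)
      ; resp    = λ f≈g f∈ r → subst (member U) (f≈g r) (f∈ r)
      ; precomp = λ f g f∈ r → f∈ (fun g r)
      }
    ; closed = λ h cover r →
        let _ , _ , hg∈ , q , gq≡r = cover r
        in subst (member U) (cong (fun h) gq≡r) (hg∈ q)
    }

  toUpSet-cong : ∀ S T → S ≈Ω T → toUpSet S ≈𝒰 toUpSet T
  toUpSet-cong _ _ S≈T p = S≈T (cone P p)

  fromUpSet-cong : ∀ U V → U ≈𝒰 V → fromUpSet U ≈Ω fromUpSet V
  fromUpSet-cong _ _ U≈V h = mk⇔ (λ h∈U r → Equivalence.to (U≈V (fun h r)) (h∈U r))
                             (λ h∈V r → Equivalence.from (U≈V (fun h r)) (h∈V r))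

  toUpSet-fromUpSet : ∀ U → toUpSet (fromUpSet U) ≈𝒰 U
  toUpSet-fromUpSet U p =
    mk⇔ (λ cone∈U → subst (member U) (Cones.collapse-above P p ≤-refl) (cone∈U (suc p)))
        (λ p∈U a → upward U (Cones.p≤collapse P p a) p∈U)

  fromUpSet-toUpSet : ∀ S → fromUpSet (toUpSet S) ≈Ω S
  fromUpSet-toUpSet S h = ⇔-sym (∋⇔cones∋ S h)

lemma3p6 : (P : FinPoset) → Inverse (ΩSetoid P) (UpSetoid P)
lemma3p6 P = record
  { to        = toUpSet
  ; from      = fromUpSet
  ; to-cong   = λ {S} {T} → toUpSet-cong S T
  ; from-cong = λ {U} {V} → fromUpSet-cong U V
  ; inverse   =
      (λ {U} {S} S≈U′ p → ⇔-trans (toUpSet-cong S (fromUpSet U) S≈U′ p) (toUpSet-fromUpSet U p)) ,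
      (λ {S} {U} U≈S′ h → ⇔-trans (fromUpSet-cong U (toUpSet S) U≈S′ h) (fromUpSet-toUpSet S h))
  }
  where open UpSetCorrespondence P
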